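{- Let $\mathfrak g\in\{A_2,C_2,G_2\}$ and let $a,b\ge0$ be integers. Then $L^{\beta\alpha}_{\mathfrak g}(a,b)\cong L^{\alpha\beta}_{\mathfrak g}(a,b)$ as edge-colored posets if and only if $a=0$ or $b=0$.
   Context: An isomorphism of edge-colored posets is a bijection preserving covering relations in both directions together with their colors. Fundamental posets ($u\lessdot v$ means $v$ covers $u$; data (color, chain index)): $A_2$: $F(1,0)$: $z_2\lessdot z_1$, $z_2:(\beta,2)$, $z_1:(\alpha,1)$; $F(0,1)$: $w_2\lessdot w_1$, $w_2:(\alpha,2)$, $w_1:(\beta,1)$. $C_2$: $F(1,0)$: $z_3\lessdot z_2\lessdot z_1$, $z_3:(\alpha,3)$, $z_2:(\beta,2)$, $z_1:(\alpha,1)$; $F(0,1)$: $w_4\lessdot w_3\lessdot w_2\lessdot w_1$, $w_4:(\beta,3)$, $w_3:(\alpha,2)$, $w_2:(\alpha,2)$, $w_1:(\beta,1)$. $G_2$: $F(1,0)$: $z_6\lessdot\cdots\lessdot z_1$, $z_6:(\alpha,5)$, $z_5:(\beta,4)$, $z_4:(\alpha,3)$, $z_3:(\alpha,3)$, $z_2:(\beta,2)$, $z_1:(\alpha,1)$; $F(0,1)$: $a_1,\dots,a_{10}$ with covers $a_1\lessdot a_2\lessdot a_3$, $a_3\lessdot a_4$, $a_3\lessdot a_6$, $a_4\lessdot a_5$, $a_4\lessdot a_7$, $a_6\lessdot a_7$, $a_5\lessdot a_8$, $a_7\lessdot a_8$, $a_8\lessdot a_9\lessdot a_{10}$, and $a_1:(\beta,5)$;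 $a_2,a_3,a_6:(\alpha,4)$; $a_4,a_7:(\beta,3)$; $a_5,a_8,a_9:(\alpha,2)$; $a_{10}:(\beta,1)$. $P^{\beta\alpha}_{\mathfrak g}(a,b)$: disjoint copies $Q_1,\dots,Q_b$ of $F(0,1)$ followed by $Q_{b+1},\dots,Q_{a+b}$ of $F(1,0)$; colors kept; chain index as in the fundamental poset for copies of $F(0,1)$ and plus $1$ for copies of $F(1,0)$; order = smallest partial order containing each $Q_i$'s order and $x<y$ whenever $x\in Q_i$, $y\in Q_j$, $i<j$, with equal chain index. $P^{\alpha\beta}_{\mathfrak g}(a,b)$: same with $Q_1,\dots,Q_a$ copies of $F(1,0)$ (indices unchanged) followed by $Q_{a+1},\dots,Q_{a+b}$ copies of $F(0,1)$ (indices plus $1$). $L^{\beta\alpha}_{\mathfrak g}(a,b)$, $L^{\alpha\beta}_{\mathfrak g}(a,b)$ are their lattices of order ideals ordered by inclusion, a cover $s\subset t$ with $t\setminus s=\{u\}$ colored by the color of $u$. -}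

module Defs where

open import Data.Nat using (ℕ; zero; suc; _+_; _<_; _≤ᵇ_)
open import Data.Bool using (Bool; true; false; if_then_else_)
open import Data.Product using (Σ; _×_; _,_)
open import Data.Sum using (_⊎_)
open import Data.List using (List; []; _∷_; map; concatMap; upTo; length; lookup)
open import Data.List.Membership.Propositional using () renaming (_∈_ to _∈ₗ_)
open import Data.Fin using (Fin)
open import Data.Fin.Subset using (Subset; _∈_; _∉_; _⊆_)
open import Relation.Binary.PropositionalEquality using (_≡_)
open import Relation.Binary.Construct.Closure.ReflexiveTransitive using (Star)

data Lie : Set where
  A₂ C₂ G₂ : Lie

data Color : Set where
  α β : Color

data Kind : Set where
  F10 F01 : Kind

-- Fundamental posets.  Elements are numbered by positions 1..size,
-- exactly as in the paper (z_1,…,z_n, resp. w_1,…, resp. a_1,…,a_10).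

size : Lie → Kind → ℕ
size A₂ F10 = 2
size A₂ F01 = 2
size C₂ F10 = 3
size C₂ F01 = 4
size G₂ F10 = 6
size G₂ F01 = 10

-- covering pairs (u , v) meaning u ⋖ v (v covers u)
fcovers : Lie → Kind → List (ℕ × ℕ)
fcovers A₂ F10 = (2 , 1) ∷ []
fcovers A₂ F01 = (2 , 1) ∷ []
fcovers C₂ F10 = (3 , 2) ∷ (2 , 1) ∷ []
fcovers C₂ F01 = (4 , 3) ∷ (3 , 2) ∷ (2 , 1) ∷ []
fcovers G₂ F10 = (6 , 5) ∷ (5 , 4) ∷ (4 , 3) ∷ (3 , 2) ∷ (2 , 1) ∷ []
fcovers G₂ F01 =
  (1 , 2) ∷ (2 , 3) ∷ (3 , 4) ∷ (3 , 6) ∷ (4 , 5) ∷ (4 , 7) ∷ (6 , 7) ∷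
  (5 , 8) ∷ (7 , 8) ∷ (8 , 9) ∷ (9 , 10) ∷ []

fcolor : Lie → Kind → ℕ → Color
fcolor A₂ F10 2 = β
fcolor A₂ F10 _ = α
fcolor A₂ F01 2 = α
fcolor A₂ F01 _ = β
fcolor C₂ F10 2 = β
fcolor C₂ F10 _ = α
fcolor C₂ F01 3 = α
fcolor C₂ F01 2 = α
fcolor C₂ F01 _ = β
fcolor G₂ F10 5 = β
fcolor G₂ F10 2 = β
fcolor G₂ F10 _ = α
fcolor G₂ F01 1 = β
fcolor G₂ F01 4 = β
fcolor G₂ F01 7 = β
fcolor G₂ F01 10 = β
fcolor G₂ F01 _ = α

fchain : Lie → Kind → ℕ → ℕ
fchain A₂ F10 2 = 2
fchain A₂ F10 _ = 1
fchain A₂ F01 2 = 2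
fchain A₂ F01 _ = 1
fchain C₂ F10 3 = 3
fchain C₂ F10 2 = 2
fchain C₂ F10 _ = 1
fchain C₂ F01 4 = 3
fchain C₂ F01 3 = 2
fchain C₂ F01 2 = 2
fchain C₂ F01 _ = 1
fchain G₂ F10 6 = 5
fchain G₂ F10 5 = 4
fchain G₂ F10 4 = 3
fchain G₂ F10 3 = 3
fchain G₂ F10 2 = 2
fchain G₂ F10 _ = 1
fchain G₂ F01 1 = 5
fchain G₂ F01 2 = 4
fchain G₂ F01 3 = 4
fchain G₂ F01 6 = 4
fchain G₂ F01 4 = 3
fchain G₂ F01 7 = 3
fchain G₂ F01 5 = 2
fchain G₂ F01 8 = 2
fchain G₂ F01 9 = 2
fchain G₂ F01 _ = 1

data Order : Set where
  βα αβ : Order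

-- kind of the i-th copy Q_{i+1} (blocks numbered 0 … a+b-1)
blockKind : Order → ℕ → ℕ → ℕ → Kind
blockKind βα a b i = if suc i ≤ᵇ b then F01 else F10
blockKind αβ a b i = if suc i ≤ᵇ a then F10 else F01

-- chain index shift: +1 for the copies placed second
shift : Order → Kind → ℕ
shift βα F01 = 0
shift βα F10 = 1
shift αβ F10 = 0
shift αβ F01 = 1

record Elt : Set where
  constructor elt
  field
    block : ℕ
    kind  : Kind
    pos   : ℕ
open Elt public

elems : Lie → Order → ℕ → ℕ → List Elt
elems g o a b =
  concatMap (λ i → map (λ p → elt i (blockKind o a b i) (suc p))
                       (upTo (size g (blockKind o a b i))))
            (upTo (a + b))

module Poset (g : Lie) (o : Order) (a b : ℕ) where

  N : ℕ
  N = length (elems g o a b)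

  El : Set
  El = Fin N

  at : El → Elt
  at = lookup (elems g o a b)

  colorOf : El → Color
  colorOf x = fcolor g (kind (at x)) (pos (at x))

  chainOf : El → ℕ
  chainOf x = fchain g (kind (at x)) (pos (at x)) + shift o (kind (at x))

  Gen : El → El → Set
  Gen x y =
    (block (at x) ≡ block (at y) ×
       (pos (at x) , pos (at y)) ∈ₗ fcovers g (kind (at x)))
    ⊎ (block (at x) < block (at y) × chainOf x ≡ chainOf y)

  _≤P_ : El → El → Set
  _≤P_ = Star Gen

  IsIdeal : Subset N → Set
  IsIdeal s = ∀ x y → x ≤P y → y ∈ s → x ∈ s

  Cover : Color → Subset N → Subset N → Set
  Cover c s t =
    s ⊆ t × Σ El (λ u → u ∉ s × u ∈ t × (∀ x → x ∈ t → x ∉ s → x ≡ u)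
                         × colorOf u ≡ c)

record Iso (g : Lie) (o₁ o₂ : Order) (a b : ℕ) : Set where
  module L₁ = Poset g o₁ a b
  module L₂ = Poset g o₂ a b
  field
    to      : Subset L₁.N → Subset L₂.N
    from    : Subset L₂.N → Subset L₁.N
    to-ideal   : ∀ s → L₁.IsIdeal s → L₂.IsIdeal (to s)
    from-ideal : ∀ t → L₂.IsIdeal t → L₁.IsIdeal (from t)
    from-to : ∀ s → L₁.IsIdeal s → from (to s) ≡ s
    to-from : ∀ t → L₂.IsIdeal t → to (from t) ≡ t
    preserves : ∀ c s t → L₁.IsIdeal s → L₁.IsIdeal t →
                L₁.Cover c s t → L₂.Cover c (to s) (to t)
    reflects  : ∀ c s t → L₁.IsIdeal s → L₁.IsIdeal t →
                L₂.Cover c (to s) (to t) → L₁.Cover c s t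

module Submission where

-- If a = 0 or b = 0, every copy has the same kind in both posets, so they have
-- the same elements and (the chain shift being uniform) the same order.
--
-- If a, b > 0 we use a fork of colors (c, c'): the empty ideal covered with
-- color c by an atom s, itself covered with color c' by two distinct ideals.
-- Isomorphisms carry forks to forks (the empty ideal is the only ideal without
-- lower covers).  In P^{βα} the minimum of the first copy of F(0,1) gives a
-- fork; in P^{αβ} the atom of color c is the minimum of the first copy of
-- F(0,1), and the only element of color c' lying over it alone is the minimum
-- of the first copy of F(1,0), so there is no fork.

open import Defs
open import Data.Nat using (ℕ)
open import Data.Sum using (_⊎_)
open import Function.Bundles using (_⇔_)
open import Relation.Binary.PropositionalEquality using (_≡_)

open import Data.Bool using (true; false; if_then_else_)
open import Data.Empty using (⊥; ⊥-elim)
open import Data.Fin using (Fin; zero; suc; toℕ; #_)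
open import Data.Fin.Properties using (toℕ<n) renaming (_≟_ to _≟ᶠ_)
open import Data.Fin.Subset using (Subset; _∈_; _∉_; _⊆_; _∪_; _∩_; ∁; ⁅_⁆)
  renaming (⊥ to ∅)
open import Data.Fin.Subset.Properties
  using (_∈?_; ∉⊥; x∈⁅x⁆; x∈⁅y⁆⇒x≡y; x≢y⇒x∉⁅y⁆; x∉⁅y⁆⇒x≢y; x∈p∪q⁻; x∈p∪q⁺;
         x∈p∩q⁻; x∈p∩q⁺; x∈∁p⇒x∉p; x∉p⇒x∈∁p; ⊆-antisym)
open import Data.List using (List; _∷_; map; concat; upTo; allFin; filter; lookup; length)
open import Data.List.Extrema.Nat using (argmax; argmax-all; f[xs]≤f[argmax])
open import Data.List.Membership.Propositional using (find; lose) renaming (_∈_ to _∈ₗ_)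
open import Data.List.Membership.Propositional.Properties
  using (∈-concatMap⁻; ∈-concatMap⁺; ∈-map⁻; ∈-map⁺; ∈-upTo⁻; ∈-upTo⁺; ∈-lookup;
         ∈-filter⁺; ∈-allFin)
open import Data.List.Properties using (map-cong-local)
open import Data.List.Relation.Unary.All as All using (All; all?)
open import Data.List.Relation.Unary.All.Properties using (all-filter)
import Data.List.Relation.Unary.All.Properties as AllProperties
open import Data.List.Relation.Unary.AllPairs using (_∷_)
import Data.List.Relation.Unary.AllPairs.Properties as AllPairs
open import Data.List.Relation.Unary.Any using (index)
open import Data.List.Relation.Unary.Any.Properties using (lookup-index)
open import Data.List.Relation.Unary.Unique.Propositional using (Unique)
import Data.List.Relation.Unary.Unique.Propositional.Properties as Unique
open import Data.Nat using (zero; suc; _+_; _*_; _∸_; _⊓_; _<_; _≤_; _≤ᵇ_; _≟_; _<?_; s≤s; z≤n)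
open import Data.Nat.Properties
open import Data.Product using (Σ; ∃; _×_; _,_; proj₁; proj₂)
open import Data.Product.Properties using (≡-dec)
open import Data.List.Membership.DecPropositional (≡-dec _≟_ _≟_) using ()
  renaming (_∈?_ to _∈ₗ?_)
open import Data.Sum using (inj₁; inj₂)
open import Function using (id)
open import Function.Bundles using (mk⇔)
open import Relation.Binary.Construct.Closure.ReflexiveTransitive using (Star; ε; _◅_)
  renaming (map to Star-map)
open import Relation.Binary.Definitions using (DecidableEquality)
open import Relation.Binary.PropositionalEquality
  using (_≢_; refl; sym; trans; cong; subst; subst₂; module ≡-Reasoning)
open import Relation.Nullary using (¬_; Dec; yes; no; ¬?)
open import Relation.Nullary.Decidable using (decidable-stable; map′; from-yes; _→-dec_; _×-dec_; _⊎-dec_)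

_≟ᶜ_ : DecidableEquality Color
α ≟ᶜ α = yes refl
α ≟ᶜ β = no λ ()
β ≟ᶜ α = no λ ()
β ≟ᶜ β = yes refl

-- Elements of F(k) sit at positions 1 … size g k; we index them by
-- p < size g k, the element at index p being at position suc p.
-- Covered g k q p : the element with index p covers the one with index q.
Covered : Lie → Kind → ℕ → ℕ → Set
Covered g k q p = (suc q , suc p) ∈ₗ fcovers g k

bottomIndex : (g : Lie) (k : Kind) → Fin (size g k)
bottomIndex A₂ F10 = # 1
bottomIndex A₂ F01 = # 1
bottomIndex C₂ F10 = # 2
bottomIndex C₂ F01 = # 3
bottomIndex G₂ F10 = # 5
bottomIndex G₂ F01 = # 0

bottom : Lie → Kind → ℕ
bottom g k = suc (toℕ (bottomIndex g k))

atomColor forkColor : Lie → Color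
atomColor g = fcolor g F01 (bottom g F01)
forkColor g = fcolor g F10 (bottom g F10)

atom≢fork : ∀ g → atomColor g ≢ forkColor g
atom≢fork A₂ ()
atom≢fork C₂ ()
atom≢fork G₂ ()

-- Facts about the finitely many fundamental posets are checked by evaluating
-- a decision procedure in every case.  These facts are kept opaque so that the
-- evaluation is never repeated when later lemmas are checked.
every-lie? : {P : Lie → Set} → (∀ g → Dec (P g)) → Dec (∀ g → P g)
every-lie? P? = map′ (λ { (pA , pC , pG) → λ { A₂ → pA ; C₂ → pC ; G₂ → pG } })
                     (λ p → p A₂ , p C₂ , p G₂)
                     (P? A₂ ×-dec P? C₂ ×-dec P? G₂)

every-kind? : {P : Lie → Kind → Set} → (∀ g k → Dec (P g k)) → Dec (∀ g k → P g k)
every-kind? P? = every-lie? (λ g →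
  map′ (λ { (p₁ , p₂) → λ { F10 → p₁ ; F01 → p₂ } }) (λ p → p F10 , p F01)
       (P? g F10 ×-dec P? g F01))

opaque
  bottom-minimal : ∀ g k → All (λ e → proj₂ e ≢ bottom g k) (fcovers g k)
  bottom-minimal = from-yes (every-kind? λ g k → all? (λ e → ¬? (proj₂ e ≟ bottom g k)) (fcovers g k))

opaque
  lower-cover-exists : ∀ g k {p} → p < size g k → suc p ≢ bottom g k →
                       ∃ λ q → q < size g k × Covered g k q p
  lower-cover-exists = from-yes (every-kind? λ g k →
    allUpTo? (λ p → ¬? (suc p ≟ bottom g k) →-dec
                    anyUpTo? (λ q → (suc q , suc p) ∈ₗ? fcovers g k) (size g k))
             (size g k))

-- A rank on each fundamental poset, bounded by 10 and strictly increasing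
-- along covers (F(0,1) of G₂ is numbered bottom-up, all others top-down).
rank : Lie → Kind → ℕ → ℕ
rank G₂ F01 p = p ⊓ 10
rank _  _   p = 10 ∸ p

rank≤10 : ∀ g k p → rank g k p ≤ 10
rank≤10 A₂ _   p = m∸n≤m 10 p
rank≤10 C₂ _   p = m∸n≤m 10 p
rank≤10 G₂ F10 p = m∸n≤m 10 p
rank≤10 G₂ F01 p = m⊓n≤n p 10

opaque
  rank-increasing : ∀ g k → All (λ e → rank g k (proj₁ e) < rank g k (proj₂ e)) (fcovers g k)
  rank-increasing = from-yes (every-kind? λ g k →
    all? (λ e → rank g k (proj₁ e) <? rank g k (proj₂ e)) (fcovers g k))

secondIndex : (g : Lie) → Fin (size g F01)
secondIndex A₂ = # 0
secondIndex C₂ = # 2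
secondIndex G₂ = # 1

second : Lie → ℕ
second g = suc (toℕ (secondIndex g))

opaque
  second-only-over-bottom :
    ∀ g → All (λ e → proj₂ e ≡ second g → proj₁ e ≡ bottom g F01) (fcovers g F01)
  second-only-over-bottom = from-yes (every-lie? λ g →
    all? (λ e → (proj₂ e ≟ second g) →-dec (proj₁ e ≟ bottom g F01)) (fcovers g F01))

second-color : ∀ g → fcolor g F01 (second g) ≡ forkColor g
second-color A₂ = refl
second-color C₂ = refl
second-color G₂ = refl

second≢bottom : ∀ g → second g ≢ bottom g F01
second≢bottom A₂ ()
second≢bottom C₂ ()
second≢bottom G₂ ()

opaque
  F01-off-F10-bottom-chain :
    ∀ g {p} → p < size g F01 →
    fchain g F01 (suc p) + shift βα F01 ≢ fchain g F10 (bottom g F10) + shift βα F10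
  F01-off-F10-bottom-chain = from-yes (every-lie? λ g →
    allUpTo? (λ p → ¬? (fchain g F01 (suc p) + shift βα F01 ≟
                        fchain g F10 (bottom g F10) + shift βα F10))
             (size g F01))

SecondaryLower : Lie → ℕ → Set
SecondaryLower g p =
  (∃ λ q → q < size g F01 × Covered g F01 q p × suc q ≢ bottom g F01) ⊎
  (∃ λ r → r < size g F10 ×
           fchain g F10 (suc r) + shift αβ F10 ≡ fchain g F01 (suc p) + shift αβ F01)

opaque
  secondary-lower : ∀ g {p} → p < size g F01 → suc p ≢ bottom g F01 →
                    fcolor g F01 (suc p) ≡ forkColor g → SecondaryLower g p
  secondary-lower = from-yes (every-lie? λ g →
    allUpTo? (λ p → ¬? (suc p ≟ bottom g F01) →-dec
                    ((fcolor g F01 (suc p) ≟ᶜ forkColor g) →-dec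
                     (anyUpTo? (λ q → ((suc q , suc p) ∈ₗ? fcovers g F01) ×-dec
                                      ¬? (suc q ≟ bottom g F01)) (size g F01) ⊎-dec
                      anyUpTo? (λ r → fchain g F10 (suc r) + shift αβ F10 ≟
                                      fchain g F01 (suc p) + shift αβ F01) (size g F10))))
             (size g F01))

if-≤ᵇ : ∀ {A : Set} {m n} {x y : A} → m ≤ n → (if m ≤ᵇ n then x else y) ≡ x
if-≤ᵇ {m = m} {n} m≤n with m ≤ᵇ n | ≤⇒≤ᵇ m≤n
... | true | _ = refl

if-≰ᵇ : ∀ {A : Set} {m n} {x y : A} → n < m → (if m ≤ᵇ n then x else y) ≡ y
if-≰ᵇ {m = m} {n} n<m with m ≤ᵇ n | ≤ᵇ⇒≤ m n
... | false | _   = refl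
... | true  | m≤n = ⊥-elim (<⇒≱ n<m (m≤n _))

βα-F01 : ∀ {a b i} → i < b → blockKind βα a b i ≡ F01
βα-F01 = if-≤ᵇ

βα-F10 : ∀ {a b i} → b ≤ i → blockKind βα a b i ≡ F10
βα-F10 b≤i = if-≰ᵇ (s≤s b≤i)

αβ-F10 : ∀ {a b i} → i < a → blockKind αβ a b i ≡ F10
αβ-F10 = if-≤ᵇ

αβ-F01 : ∀ {a b i} → a ≤ i → blockKind αβ a b i ≡ F01
αβ-F01 a≤i = if-≰ᵇ (s≤s a≤i)

lookup-injective : ∀ {A : Set} {xs : List A} → Unique xs →
                   ∀ i j → lookup xs i ≡ lookup xs j → i ≡ j
lookup-injective {xs = _ ∷ _} _          zero    zero    _ = refl
lookup-injective {xs = _ ∷ _} (x∉ ∷ _)   zero    (suc j) e = ⊥-elim (All.lookup x∉ (∈-lookup j) e)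
lookup-injective {xs = _ ∷ _} (x∉ ∷ _)   (suc i) zero    e = ⊥-elim (All.lookup x∉ (∈-lookup i) (sym e))
lookup-injective {xs = _ ∷ _} (_ ∷ uniq) (suc i) (suc j) e = cong suc (lookup-injective uniq i j e)

module Structure (g : Lie) (o : Order) (a b : ℕ) where
  open Poset g o a b public

  K : ℕ → Kind
  K = blockKind o a b

  chainE : Elt → ℕ
  chainE e = fchain g (kind e) (pos e) + shift o (kind e)

  -- The generating relation on element descriptions: Gen x y is
  -- definitionally Generates (at x) (at y).
  Generates : Elt → Elt → Set
  Generates e e' =
    (block e ≡ block e' × (pos e , pos e') ∈ₗ fcovers g (kind e)) ⊎
    (block e < block e' × chainE e ≡ chainE e')

  Gen-from : ∀ {x y e e'} → at x ≡ e → at y ≡ e' → Generates e e' → Gen x y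
  Gen-from refl refl gen = gen

  Gen-to : ∀ {x y e e'} → at x ≡ e → at y ≡ e' → Gen x y → Generates e e'
  Gen-to refl refl gen = gen

  color-at : ∀ {x e} → at x ≡ e → colorOf x ≡ fcolor g (kind e) (pos e)
  color-at = cong (λ e → fcolor g (kind e) (pos e))

  record Location (e : Elt) : Set where
    constructor located
    field
      i : ℕ
      k : Kind
      p : ℕ
      block< : i < a + b
      kind≡ : K i ≡ k
      index< : p < size g k
      location : e ≡ elt i k (suc p)

  blockList : ℕ → List Elt
  blockList i = map (λ p → elt i (K i) (suc p)) (upTo (size g (K i)))

  opaque
    describe : (x : El) → Location (at x)
    describe x with find (∈-concatMap⁻ blockList (∈-lookup x))
    ... | i , i∈ , x∈ with ∈-map⁻ (λ p → elt i (K i) (suc p)) x∈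
    ...   | p , p∈ , ex = located i (K i) p (∈-upTo⁻ i∈) refl (∈-upTo⁻ p∈) ex

    element : ∀ {i k p} → i < a + b → K i ≡ k → p < size g k →
              Σ El λ x → at x ≡ elt i k (suc p)
    element {i} {p = p} i< refl p< = index x∈ , sym (lookup-index x∈)
      where
      x∈ : elt i (K i) (suc p) ∈ₗ elems g o a b
      x∈ = ∈-concatMap⁺ blockList
             (lose (∈-upTo⁺ i<) (∈-map⁺ (λ p → elt i (K i) (suc p)) (∈-upTo⁺ p<)))

  elems-unique : Unique (elems g o a b)
  elems-unique = Unique.concat⁺
    (AllProperties.map⁺ (All.tabulate λ _ →
      Unique.map⁺ (λ e → suc-injective (cong pos e)) (Unique.upTo⁺ _)))
    (AllPairs.map⁺ (AllPairs.applyUpTo⁺₁ id (a + b) disjoint))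
    where
    block-of : ∀ {i e} → e ∈ₗ blockList i → block e ≡ i
    block-of {i} e∈ = cong block (proj₂ (proj₂ (∈-map⁻ (λ p → elt i (K i) (suc p)) e∈)))
    disjoint : ∀ {i j} → i < j → j < a + b → ∀ {e} → ¬ (e ∈ₗ blockList i × e ∈ₗ blockList j)
    disjoint i<j _ (e∈i , e∈j) = <-irrefl (trans (sym (block-of e∈i)) (block-of e∈j)) i<j

  at-injective : ∀ {x y} → at x ≡ at y → x ≡ y
  at-injective = lookup-injective elems-unique _ _

  -- The generating relation strictly increases the height below, so the
  -- order is acyclic and every nonempty set has a maximal element.
  heightE : Elt → ℕ
  heightE e = block e * 11 + rank g (kind e) (pos e)

  height : El → ℕ
  height x = heightE (at x)

  block-dominates : ∀ {i j} r r' → i < j → r ≤ 10 → i * 11 + r < j * 11 + r'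
  block-dominates {i} {j} r r' i<j r≤10 = begin-strict
    i * 11 + r     ≤⟨ +-monoʳ-≤ (i * 11) r≤10 ⟩
    i * 11 + 10    ≡⟨ +-comm (i * 11) 10 ⟩
    10 + i * 11    <⟨ n<1+n _ ⟩
    suc i * 11     ≤⟨ *-monoˡ-≤ 11 i<j ⟩
    j * 11         ≤⟨ m≤m+n (j * 11) r' ⟩
    j * 11 + r'    ∎
    where open ≤-Reasoning

  Generates-increasing : ∀ {i j k k' n n'} → (i ≡ j → k ≡ k') →
    Generates (elt i k n) (elt j k' n') → heightE (elt i k n) < heightE (elt j k' n')
  Generates-increasing same-kind (inj₁ (refl , cov)) with same-kind refl
  ... | refl = +-monoʳ-< _ (All.lookup (rank-increasing g _) cov)
  Generates-increasing {k = k} {n = n} _ (inj₂ (i<j , _)) =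
    block-dominates _ _ i<j (rank≤10 g k n)

  Gen-increasing : ∀ {x y} → Gen x y → height x < height y
  Gen-increasing {x} {y} gen with describe x | describe y
  ... | located _ _ _ _ Ki _ ex | located _ _ _ _ Kj _ ey =
    subst₂ _<_ (cong heightE (sym ex)) (cong heightE (sym ey))
      (Generates-increasing (λ { refl → trans (sym Ki) Kj }) (Gen-to ex ey gen))

  ≤P-increasing : ∀ {x y} → x ≤P y → x ≡ y ⊎ height x < height y
  ≤P-increasing ε = inj₁ refl
  ≤P-increasing (gen ◅ rest) with ≤P-increasing rest
  ... | inj₁ refl = inj₂ (Gen-increasing gen)
  ... | inj₂ h<h  = inj₂ (<-trans (Gen-increasing gen) h<h)

  Gen-irreflexive : ∀ {x} → ¬ Gen x x
  Gen-irreflexive gen = <-irrefl refl (Gen-increasing gen)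

  lower-in-block : ∀ {x i k p q} → at x ≡ elt i k (suc p) → i < a + b → K i ≡ k →
                   q < size g k → Covered g k q p →
                   Σ El λ y → at y ≡ elt i k (suc q) × Gen y x
  lower-in-block ex i< Ki q< cov with element i< Ki q<
  ... | y , ey = y , ey , Gen-from ey ex (inj₁ (refl , cov))

  lower-of-non-bottom : ∀ {x i k p} → at x ≡ elt i k (suc p) → i < a + b → K i ≡ k →
                        p < size g k → suc p ≢ bottom g k →
                        Σ ℕ λ q → Σ El λ y → at y ≡ elt i k (suc q) × Gen y x
  lower-of-non-bottom ex i< Ki p< not-bottom with lower-cover-exists g _ p< not-bottom
  ... | q , q< , cov = q , lower-in-block ex i< Ki q< cov

  lower-in-earlier-block : ∀ {x i k p j k' r} → at x ≡ elt i k (suc p) → j < i → i < a + b →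
                           K j ≡ k' → r < size g k' →
                           chainE (elt j k' (suc r)) ≡ chainE (elt i k (suc p)) →
                           Σ El λ y → at y ≡ elt j k' (suc r) × Gen y x
  lower-in-earlier-block ex j<i i< Kj r< same-chain with element (<-trans j<i i<) Kj r<
  ... | y , ey = y , ey , Gen-from ey ex (inj₂ (j<i , same-chain))

  previous-block : ∀ {x i k p} → at x ≡ elt (suc i) k (suc p) → suc i < a + b → K i ≡ k →
                   p < size g k → Σ El λ y → at y ≡ elt i k (suc p) × Gen y x
  previous-block ex i< Ki p< = lower-in-earlier-block ex (n<1+n _) i< Ki p< refl

  minimal-is-bottom : ∀ {x i k p} → (∀ y → ¬ Gen y x) → at x ≡ elt i k (suc p) →
                      i < a + b → K i ≡ k → p < size g k → suc p ≡ bottom g k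
  minimal-is-bottom {k = k} {p} minimal ex i< Ki p< =
    decidable-stable (suc p ≟ bottom g k) λ not-bottom →
      let (_ , y , _ , y<x) = lower-of-non-bottom ex i< Ki p< not-bottom in minimal y y<x

  ideal-from-Gen : ∀ {s} → (∀ x y → Gen x y → y ∈ s → x ∈ s) → IsIdeal s
  ideal-from-Gen closed x y ε              y∈ = y∈
  ideal-from-Gen closed x y (gen ◅ x<y) y∈ = closed _ _ gen (ideal-from-Gen closed _ y x<y y∈)

  opaque
    highest : ∀ {s x} → x ∈ s → Σ El λ m → m ∈ s × (∀ y → y ∈ s → height y ≤ height m)
    highest {s} {x} x∈ = m , argmax-all height x∈ (all-filter (_∈? s) (allFin N)) , below-m
      where
      members : List El
      members = filter (_∈? s) (allFin N)
      m : El
      m = argmax height x members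
      below-m : ∀ y → y ∈ s → height y ≤ height m
      below-m y y∈ = All.lookup (f[xs]≤f[argmax] {f = height} x members)
                                (∈-filter⁺ (_∈? s) (∈-allFin y) y∈)

  lower-cover : ∀ {s x} → IsIdeal s → x ∈ s →
                Σ Color λ c → Σ (Subset N) λ r → IsIdeal r × Cover c r s
  lower-cover {s} s-ideal x∈ with highest x∈
  ... | m , m∈ , m-highest = colorOf m , r , r-ideal , (λ z∈ → proj₁ (∈r⁻ z∈)) ,
                             m , (λ m∈ → proj₂ (∈r⁻ m∈) refl) , m∈ , only-m , refl
    where
    r : Subset N
    r = s ∩ ∁ ⁅ m ⁆
    ∈r⁺ : ∀ {z} → z ∈ s → z ≢ m → z ∈ r
    ∈r⁺ z∈ z≢m = x∈p∩q⁺ (z∈ , x∉p⇒x∈∁p (x≢y⇒x∉⁅y⁆ z≢m))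
    ∈r⁻ : ∀ {z} → z ∈ r → z ∈ s × z ≢ m
    ∈r⁻ z∈ with x∈p∩q⁻ s (∁ ⁅ m ⁆) z∈
    ... | z∈s , z∈∁ = z∈s , x∉⁅y⁆⇒x≢y (x∈∁p⇒x∉p z∈∁)
    r-ideal : IsIdeal r
    r-ideal x y x≤y y∈ with ∈r⁻ y∈
    ... | y∈s , y≢m = ∈r⁺ (s-ideal x y x≤y y∈s) λ { refl → m-not-below y≢m (≤P-increasing x≤y) }
      where
      m-not-below : y ≢ m → m ≡ y ⊎ height m < height y → ⊥
      m-not-below y≢m (inj₁ m≡y) = y≢m (sym m≡y)
      m-not-below _   (inj₂ m<y) = <⇒≱ m<y (m-highest y y∈s)
    only-m : ∀ z → z ∈ s → z ∉ r → z ≡ m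
    only-m z z∈ z∉ with z ≟ᶠ m
    ... | yes z≡m = z≡m
    ... | no  z≢m = ⊥-elim (z∉ (∈r⁺ z∈ z≢m))

  adjoin : ∀ {s x c} → IsIdeal s → x ∉ s → (∀ y → Gen y x → y ∈ s) → colorOf x ≡ c →
           IsIdeal (s ∪ ⁅ x ⁆) × Cover c s (s ∪ ⁅ x ⁆)
  adjoin {s} {x} s-ideal x∉ below col =
    ideal-from-Gen closed , (λ z∈ → x∈p∪q⁺ (inj₁ z∈)) ,
    x , x∉ , x∈p∪q⁺ (inj₂ (x∈⁅x⁆ x)) , only-x , col
    where
    closed : ∀ y z → Gen y z → z ∈ s ∪ ⁅ x ⁆ → y ∈ s ∪ ⁅ x ⁆
    closed y z gen z∈ with x∈p∪q⁻ s ⁅ x ⁆ z∈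
    ... | inj₁ z∈s = x∈p∪q⁺ (inj₁ (s-ideal y z (gen ◅ ε) z∈s))
    ... | inj₂ z∈x = x∈p∪q⁺ (inj₁ (below y (subst (Gen y) (x∈⁅y⁆⇒x≡y x z∈x) gen)))
    only-x : ∀ z → z ∈ s ∪ ⁅ x ⁆ → z ∉ s → z ≡ x
    only-x z z∈ z∉ with x∈p∪q⁻ s ⁅ x ⁆ z∈
    ... | inj₁ z∈s = ⊥-elim (z∉ z∈s)
    ... | inj₂ z∈x = x∈⁅y⁆⇒x≡y x z∈x

  added : ∀ {c s t} → Cover c s t → El
  added (_ , u , _) = u

  added-color : ∀ {c s t} (cov : Cover c s t) → colorOf (added cov) ≡ c
  added-color (_ , _ , _ , _ , _ , col) = col

  added-only : ∀ {c s t} (cov : Cover c s t) → ∀ z → z ∈ t → z ∉ s → z ≡ added cov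
  added-only (_ , _ , _ , _ , only-u , _) = only-u

  cover-lower : ∀ {c s t} → IsIdeal t → (cov : Cover c s t) →
                ∀ y → Gen y (added cov) → y ∈ s
  cover-lower {s = s} t-ideal (_ , u , _ , u∈t , only-u , _) y gen with y ∈? s
  ... | yes y∈s = y∈s
  ... | no  y∉s = ⊥-elim (Gen-irreflexive
                    (subst (λ z → Gen z u) (only-u y (t-ideal y u (gen ◅ ε) u∈t) y∉s) gen))

  cover-⊆ : ∀ {c c' s t t'} (cov : Cover c s t) (cov' : Cover c' s t') →
            added cov ≡ added cov' → t ⊆ t'
  cover-⊆ {s = s} {t' = t'} (_ , _ , _ , _ , only-u , _) (s⊆t' , _ , _ , u'∈t' , _ , _) same {z} z∈t
    with z ∈? s
  ... | yes z∈s = s⊆t' z∈s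
  ... | no  z∉s = subst (_∈ t') (sym (trans (only-u z z∈t z∉s) same)) u'∈t'

  cover-determined : ∀ {c c' s t t'} (cov : Cover c s t) (cov' : Cover c' s t') →
                     added cov ≡ added cov' → t ≡ t'
  cover-determined cov cov' same = ⊆-antisym (cover-⊆ cov cov' same) (cover-⊆ cov' cov (sym same))

  record Fork (c c' : Color) : Set where
    field
      base atom upper₁ upper₂ : Subset N
      base-empty   : ∀ x → x ∉ base
      base-ideal   : IsIdeal base
      atom-ideal   : IsIdeal atom
      upper₁-ideal : IsIdeal upper₁
      upper₂-ideal : IsIdeal upper₂
      base⋖atom    : Cover c base atom
      atom⋖upper₁  : Cover c' atom upper₁
      atom⋖upper₂  : Cover c' atom upper₂
      distinct     : upper₁ ≢ upper₂

-- An isomorphism of the colored lattices of ideals carries forks to forks: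
-- the image of the empty ideal has no lower cover, hence is empty.
transport-fork : ∀ {g o₁ o₂ a b c c'} → Iso g o₁ o₂ a b →
                 Structure.Fork g o₁ a b c c' → Structure.Fork g o₂ a b c c'
transport-fork {g} {o₁} {o₂} {a} {b} {c} {c'} iso fork = record
  { base         = to base
  ; atom         = to atom
  ; upper₁       = to upper₁
  ; upper₂       = to upper₂
  ; base-empty   = image-empty
  ; base-ideal   = to-ideal base base-ideal
  ; atom-ideal   = to-ideal atom atom-ideal
  ; upper₁-ideal = to-ideal upper₁ upper₁-ideal
  ; upper₂-ideal = to-ideal upper₂ upper₂-ideal
  ; base⋖atom    = preserves c base atom base-ideal atom-ideal base⋖atom
  ; atom⋖upper₁  = preserves c' atom upper₁ atom-ideal upper₁-ideal atom⋖upper₁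
  ; atom⋖upper₂  = preserves c' atom upper₂ atom-ideal upper₂-ideal atom⋖upper₂
  ; distinct     = λ same → distinct (begin
      upper₁           ≡⟨ from-to upper₁ upper₁-ideal ⟨
      from (to upper₁) ≡⟨ cong from same ⟩
      from (to upper₂) ≡⟨ from-to upper₂ upper₂-ideal ⟩
      upper₂           ∎)
  }
  where
  open Iso iso
  open Structure.Fork fork
  open ≡-Reasoning
  module P₂ = Structure g o₂ a b
  image-empty : ∀ x → x ∉ to base
  image-empty x x∈ with P₂.lower-cover (to-ideal base base-ideal) x∈
  ... | d , r , r-ideal , r⋖image
    with reflects d (from r) base (from-ideal r r-ideal) base-ideal
           (subst (λ r' → P₂.Cover d r' (to base)) (sym (to-from r r-ideal)) r⋖image)
  ...   | _ , u , _ , u∈base , _ = base-empty u u∈base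

-- In P^{αβ}_g(a'+1, b) the atoms of color atomColor g and their covers of
-- color forkColor g are unique, so there is no fork.
module NoForkαβ (g : Lie) (a' b : ℕ) where
  a : ℕ
  a = suc a'
  open Structure g αβ a b

  K-F10 : ∀ {i} → i < a → K i ≡ F10
  K-F10 = αβ-F10 {a} {b}

  K-F01 : ∀ {i} → a ≤ i → K i ≡ F01
  K-F01 = αβ-F01 {a} {b}

  atomE forkE : Elt
  atomE = elt a F01 (bottom g F01)
  forkE = elt 0 F10 (bottom g F10)

  off-block : ∀ {y j k n} → at y ≡ elt j k n → j ≢ a → at y ≢ atomE
  off-block ey j≢a ey' = j≢a (cong block (trans (sym ey) ey'))

  below-a : ∀ {i} → i < a → i < a + b
  below-a i<a = <-≤-trans i<a (m≤m+n a b)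

  -- A minimal element of color atomColor g is the minimum of its copy; copies
  -- of F(1,0) have minima of the other color, and a copy of F(0,1) after the
  -- first lies above the previous one.  So it is atomE.
  minimal-atom : ∀ x → colorOf x ≡ atomColor g → (∀ y → ¬ Gen y x) → at x ≡ atomE
  minimal-atom x col minimal with describe x
  ... | located i k p i< Ki p< ex with minimal-is-bottom minimal ex i< Ki p< | i <? a
  ...   | at-bottom | yes i<a with trans (sym Ki) (K-F10 i<a)
  ...     | refl = ⊥-elim (atom≢fork g
                      (trans (sym col) (trans (color-at ex) (cong (fcolor g F10) at-bottom))))
  minimal-atom x col minimal | located i k p i< Ki p< ex | at-bottom | no i≮a
    with trans (sym Ki) (K-F01 (≮⇒≥ i≮a)) | m≤n⇒m<n∨m≡n (≮⇒≥ i≮a)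
  ... | refl | inj₂ refl       = trans ex (cong (elt a F01) at-bottom)
  ... | refl | inj₁ (s≤s a≤j) =
    let (y , _ , y<x) = previous-block ex i< (K-F01 a≤j) p< in ⊥-elim (minimal y y<x)

  over-atom-F10 : ∀ {v i p} → at v ≡ elt i F10 (suc p) → i < a → p < size g F10 →
                  (∀ y → Gen y v → at y ≡ atomE) → at v ≡ forkE
  over-atom-F10 {p = p} ev i<a p< lower with suc p ≟ bottom g F10
  ... | no not-bottom with lower-of-non-bottom ev (below-a i<a) (K-F10 i<a) p< not-bottom
  ...   | _ , y , ey , y<v = ⊥-elim (off-block ey (<⇒≢ i<a) (lower y y<v))
  over-atom-F10 {i = zero}  ev _ _ _ | yes at-bottom = trans ev (cong (elt 0 F10) at-bottom)
  over-atom-F10 {i = suc j} ev i<a p< lower | yes _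
    with previous-block ev (below-a i<a) (K-F10 (<-trans (n<1+n j) i<a)) p<
  ... | y , ey , y<v = ⊥-elim (off-block ey (<⇒≢ (<-trans (n<1+n j) i<a)) (lower y y<v))

  over-atom-F01 : ∀ {v i p} → at v ≡ elt i F01 (suc p) → a ≤ i → i < a + b → p < size g F01 →
                  colorOf v ≡ forkColor g → ¬ (∀ y → Gen y v → at y ≡ atomE)
  over-atom-F01 {p = p} ev a≤i i< p< col lower with suc p ≟ bottom g F01
  ... | yes at-bottom = atom≢fork g
          (trans (cong (fcolor g F01) (sym at-bottom)) (trans (sym (color-at ev)) col))
  ... | no not-bottom with _ ≟ a
  ...   | no i≢a with lower-of-non-bottom ev i< (K-F01 a≤i) p< not-bottom
  ...     | _ , y , ey , y<v = off-block ey i≢a (lower y y<v)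
  over-atom-F01 ev a≤i i< p< col lower | no not-bottom | yes refl
    with secondary-lower g p< not-bottom (trans (sym (color-at ev)) col)
  ... | inj₁ (q , q< , cov , q≢bottom) with lower-in-block ev i< (K-F01 a≤i) q< cov
  ...   | y , ey , y<v = q≢bottom (cong pos (trans (sym ey) (lower y y<v)))
  over-atom-F01 ev a≤i i< p< col lower | no not-bottom | yes refl | inj₂ (r , r< , same-chain)
    with lower-in-earlier-block ev (n<1+n a') i< (K-F10 (n<1+n a')) r< same-chain
  ... | y , ey , y<v = off-block ey (<⇒≢ (n<1+n a')) (lower y y<v)

  over-atom : ∀ v → colorOf v ≡ forkColor g → (∀ y → Gen y v → at y ≡ atomE) → at v ≡ forkE
  over-atom v col lower with describe v
  ... | located i k p i< Ki p< ev with i <? a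
  ...   | yes i<a with trans (sym Ki) (K-F10 i<a)
  ...     | refl = over-atom-F10 ev i<a p< lower
  over-atom v col lower | located i k p i< Ki p< ev | no i≮a with trans (sym Ki) (K-F01 (≮⇒≥ i≮a))
  ... | refl = ⊥-elim (over-atom-F01 ev (≮⇒≥ i≮a) i< p< col lower)

  -- In a fork the atom is a single minimal element, hence atomE, and both
  -- upper covers add elements lying over it alone, hence both add forkE.
  no-fork : ¬ Fork (atomColor g) (forkColor g)
  no-fork fork = distinct (cover-determined atom⋖upper₁ atom⋖upper₂
                   (at-injective (trans (upper-at upper₁-ideal atom⋖upper₁)
                                        (sym (upper-at upper₂-ideal atom⋖upper₂)))))
    where
    open Fork fork
    u : El
    u = added base⋖atom
    only-u : ∀ z → z ∈ atom → z ≡ u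
    only-u z z∈ = added-only base⋖atom z z∈ (base-empty z)
    u-at : at u ≡ atomE
    u-at = minimal-atom u (added-color base⋖atom)
             (λ y y<u → base-empty y (cover-lower atom-ideal base⋖atom y y<u))
    upper-at : ∀ {t} → IsIdeal t → (cov : Cover (forkColor g) atom t) → at (added cov) ≡ forkE
    upper-at t-ideal cov = over-atom (added cov) (added-color cov)
      (λ y y<v → trans (cong at (only-u y (cover-lower t-ideal cov y y<v))) u-at)

-- In P^{βα}_g(a'+1, b'+1) the minimum m of block 0 (a copy of F(0,1)) is an
-- atom covered by two ideals: one adds the element w of block 0 at position
-- `second g`, the other the minimum v of block b (the first copy of F(1,0)).
module Forkβα (g : Lie) (a' b' : ℕ) where
  a b : ℕ
  a = suc a'
  b = suc b'
  open Structure g βα a b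

  K-F01 : ∀ {i} → i < b → K i ≡ F01
  K-F01 = βα-F01 {a} {b}

  K-F10 : ∀ {i} → b ≤ i → K i ≡ F10
  K-F10 = βα-F10 {a} {b}

  0<b : 0 < b
  0<b = s≤s z≤n

  0<a+b : 0 < a + b
  0<a+b = s≤s z≤n

  b<a+b : b < a + b
  b<a+b = s≤s (m≤n+m b a')

  m-element : Σ El λ x → at x ≡ elt 0 F01 (bottom g F01)
  m-element = element 0<a+b (K-F01 0<b) (toℕ<n (bottomIndex g F01))

  w-element : Σ El λ x → at x ≡ elt 0 F01 (second g)
  w-element = element 0<a+b (K-F01 0<b) (toℕ<n (secondIndex g))

  v-element : Σ El λ x → at x ≡ elt b F10 (bottom g F10)
  v-element = element b<a+b (K-F10 ≤-refl) (toℕ<n (bottomIndex g F10))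

  m w v : El
  m = proj₁ m-element
  w = proj₁ w-element
  v = proj₁ v-element

  m-at : at m ≡ elt 0 F01 (bottom g F01)
  m-at = proj₂ m-element

  w-at : at w ≡ elt 0 F01 (second g)
  w-at = proj₂ w-element

  v-at : at v ≡ elt b F10 (bottom g F10)
  v-at = proj₂ v-element

  m-minimal : ∀ y → ¬ Gen y m
  m-minimal y y<m with describe y
  ... | located i k p _ Ki _ ey with Gen-to ey m-at y<m
  ...   | inj₁ (refl , cov) with Ki
  ...     | refl = All.lookup (bottom-minimal g F01) cov refl

  w-lower : ∀ y → Gen y w → y ≡ m
  w-lower y y<w with describe y
  ... | located i k p _ Ki _ ey with Gen-to ey w-at y<w
  ...   | inj₁ (refl , cov) with Ki
  ...     | refl = at-injective (begin
                     at y                      ≡⟨ ey ⟩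
                     elt 0 F01 (suc p)         ≡⟨ cong (elt 0 F01) below-second ⟩
                     elt 0 F01 (bottom g F01)  ≡⟨ m-at ⟨
                     at m                      ∎)
    where
    open ≡-Reasoning
    below-second : suc p ≡ bottom g F01
    below-second = All.lookup (second-only-over-bottom g) cov refl

  -- v is minimal: it is the minimum of its copy, and no element of the
  -- earlier copies of F(0,1) lies in its chain.
  v-minimal : ∀ y → ¬ Gen y v
  v-minimal y y<v with describe y
  ... | located i k p _ Ki p< ey with Gen-to ey v-at y<v
  ...   | inj₁ (refl , cov) with trans (sym Ki) (K-F10 ≤-refl)
  ...     | refl = All.lookup (bottom-minimal g F10) cov refl
  v-minimal y y<v | located i k p _ Ki p< ey | inj₂ (i<b , same-chain)
    with trans (sym Ki) (K-F01 i<b)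
  ... | refl = F01-off-F10-bottom-chain g p< same-chain

  ∅-ideal : IsIdeal ∅
  ∅-ideal _ _ _ y∈ = ⊥-elim (∉⊥ y∈)

  atom : Subset N
  atom = ∅ ∪ ⁅ m ⁆

  atom-adjoined : IsIdeal atom × Cover (atomColor g) ∅ atom
  atom-adjoined = adjoin ∅-ideal ∉⊥ (λ y y<m → ⊥-elim (m-minimal y y<m)) (color-at m-at)

  in-atom : ∀ {z} → z ∈ atom → z ≡ m
  in-atom z∈ with x∈p∪q⁻ ∅ ⁅ m ⁆ z∈
  ... | inj₁ z∈∅ = ⊥-elim (∉⊥ z∈∅)
  ... | inj₂ z∈m = x∈⁅y⁆⇒x≡y m z∈m

  w∉atom : w ∉ atom
  w∉atom w∈ = second≢bottom g (cong pos (trans (sym w-at) (trans (cong at (in-atom w∈)) m-at)))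

  v∉atom : v ∉ atom
  v∉atom v∈ with cong block (trans (sym v-at) (trans (cong at (in-atom v∈)) m-at))
  ... | ()

  w≢v : w ≢ v
  w≢v w≡v with cong block (trans (sym w-at) (trans (cong at w≡v) v-at))
  ... | ()

  upper₁-adjoined : IsIdeal (atom ∪ ⁅ w ⁆) × Cover (forkColor g) atom (atom ∪ ⁅ w ⁆)
  upper₁-adjoined = adjoin (proj₁ atom-adjoined) w∉atom
    (λ y y<w → subst (_∈ atom) (sym (w-lower y y<w)) (x∈p∪q⁺ (inj₂ (x∈⁅x⁆ m))))
    (trans (color-at w-at) (second-color g))

  upper₂-adjoined : IsIdeal (atom ∪ ⁅ v ⁆) × Cover (forkColor g) atom (atom ∪ ⁅ v ⁆)
  upper₂-adjoined = adjoin (proj₁ atom-adjoined) v∉atom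
    (λ y y<v → ⊥-elim (v-minimal y y<v)) (color-at v-at)

  fork : Fork (atomColor g) (forkColor g)
  fork = record
    { base = ∅ ; atom = atom ; upper₁ = atom ∪ ⁅ w ⁆ ; upper₂ = atom ∪ ⁅ v ⁆
    ; base-empty   = λ _ → ∉⊥
    ; base-ideal   = ∅-ideal
    ; atom-ideal   = proj₁ atom-adjoined
    ; upper₁-ideal = proj₁ upper₁-adjoined
    ; upper₂-ideal = proj₁ upper₂-adjoined
    ; base⋖atom    = proj₂ atom-adjoined
    ; atom⋖upper₁  = proj₂ upper₁-adjoined
    ; atom⋖upper₂  = proj₂ upper₂-adjoined
    ; distinct     = distinct
    }
    where
    distinct : atom ∪ ⁅ w ⁆ ≢ atom ∪ ⁅ v ⁆
    distinct same with x∈p∪q⁻ atom ⁅ v ⁆ (subst (w ∈_) same (x∈p∪q⁺ (inj₂ (x∈⁅x⁆ w))))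
    ... | inj₁ w∈atom = w∉atom w∈atom
    ... | inj₂ w∈v    = w≢v (x∈⁅y⁆⇒x≡y v w∈v)

-- Ideals and colored covers make sense for any colored relation on Fin N;
-- for the generating relation of a poset they are Poset.IsIdeal and Poset.Cover.
module Ideals {N : ℕ} (R : Fin N → Fin N → Set) (color : Fin N → Color) where
  IsIdeal : Subset N → Set
  IsIdeal s = ∀ x y → Star R x y → y ∈ s → x ∈ s

  Cover : Color → Subset N → Subset N → Set
  Cover c s t = s ⊆ t × Σ (Fin N) (λ u → u ∉ s × u ∈ t × (∀ x → x ∈ t → x ∉ s → x ≡ u)
                                           × color u ≡ c)

record IdealIso {N₁ N₂ : ℕ} (R₁ : Fin N₁ → Fin N₁ → Set) (R₂ : Fin N₂ → Fin N₂ → Set)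
                (color₁ : Fin N₁ → Color) (color₂ : Fin N₂ → Color) : Set where
  module L₁ = Ideals R₁ color₁
  module L₂ = Ideals R₂ color₂
  field
    to         : Subset N₁ → Subset N₂
    from       : Subset N₂ → Subset N₁
    to-ideal   : ∀ s → L₁.IsIdeal s → L₂.IsIdeal (to s)
    from-ideal : ∀ t → L₂.IsIdeal t → L₁.IsIdeal (from t)
    from-to    : ∀ s → L₁.IsIdeal s → from (to s) ≡ s
    to-from    : ∀ t → L₂.IsIdeal t → to (from t) ≡ t
    preserves  : ∀ c s t → L₁.IsIdeal s → L₁.IsIdeal t →
                 L₁.Cover c s t → L₂.Cover c (to s) (to t)
    reflects   : ∀ c s t → L₁.IsIdeal s → L₁.IsIdeal t →
                 L₂.Cover c (to s) (to t) → L₁.Cover c s t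

relabel : ∀ {N₁ N₂} (e : N₁ ≡ N₂) {R₁ R₂ color₁ color₂} →
          (∀ x y → R₁ x y → R₂ (subst Fin e x) (subst Fin e y)) →
          (∀ x y → R₂ (subst Fin e x) (subst Fin e y) → R₁ x y) →
          (∀ x → color₁ x ≡ color₂ (subst Fin e x)) →
          IdealIso R₁ R₂ color₁ color₂
relabel refl forward backward same-color = record
  { to         = id
  ; from       = id
  ; to-ideal   = λ s s-ideal x y x≤y → s-ideal x y (Star-map (backward _ _) x≤y)
  ; from-ideal = λ s s-ideal x y x≤y → s-ideal x y (Star-map (forward _ _) x≤y)
  ; from-to    = λ _ _ → refl
  ; to-from    = λ _ _ → refl
  ; preserves  = λ { c s t _ _ (s⊆t , u , u∉ , u∈ , only , col) →
                     s⊆t , u , u∉ , u∈ , only , trans (sym (same-color u)) col }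
  ; reflects   = λ { c s t _ _ (s⊆t , u , u∉ , u∈ , only , col) →
                     s⊆t , u , u∉ , u∈ , only , trans (same-color u) col }
  }

lookup-relabel : ∀ {A : Set} {xs ys : List A} (e : xs ≡ ys) i →
                 lookup ys (subst Fin (cong length e) i) ≡ lookup xs i
lookup-relabel refl i = refl

-- The generating relation of P^o_g(a,b) between elements of one kind k₀ does
-- not depend on o: the chain shift of o is the same on both sides.
reshift : ∀ {g o o' a b k₀} e e' → kind e ≡ k₀ → kind e' ≡ k₀ →
          Structure.Generates g o a b e e' → Structure.Generates g o' a b e e'
reshift (elt _ _ _) (elt _ _ _) refl refl (inj₁ in-block) = inj₁ in-block
reshift {o = o} {o'} {k₀ = k₀} (elt _ _ _) (elt _ _ _) refl refl (inj₂ (i<j , same-chain)) =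
  inj₂ (i<j , cong (_+ shift o' k₀) (+-cancelʳ-≡ (shift o k₀) _ _ same-chain))

uniform-iso : ∀ g o₁ o₂ a b k₀ →
              (∀ i → i < a + b → blockKind o₁ a b i ≡ k₀) →
              (∀ i → i < a + b → blockKind o₂ a b i ≡ k₀) → Iso g o₁ o₂ a b
uniform-iso g o₁ o₂ a b k₀ kinds₁ kinds₂ = record
  { to = to ; from = from ; to-ideal = to-ideal ; from-ideal = from-ideal
  ; from-to = from-to ; to-from = to-from ; preserves = preserves ; reflects = reflects }
  where
  module P₁ = Structure g o₁ a b
  module P₂ = Structure g o₂ a b

  same-elements : elems g o₁ a b ≡ elems g o₂ a b
  same-elements = cong concat (map-cong-local (All.tabulate λ {i} i∈ →
    cong (λ k → map (λ p → elt i k (suc p)) (upTo (size g k)))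
         (trans (kinds₁ i (∈-upTo⁻ i∈)) (sym (kinds₂ i (∈-upTo⁻ i∈))))))

  same-size : P₁.N ≡ P₂.N
  same-size = cong length same-elements

  at-relabel : ∀ x → P₂.at (subst Fin same-size x) ≡ P₁.at x
  at-relabel = lookup-relabel same-elements

  kind-of : ∀ x → kind (P₁.at x) ≡ k₀
  kind-of x with P₁.describe x
  ... | P₁.located i k p i< Ki _ ex = trans (cong kind ex) (trans (sym Ki) (kinds₁ i i<))

  open IdealIso (relabel same-size {P₁.Gen} {P₂.Gen} {P₁.colorOf} {P₂.colorOf}
    (λ x y x<y → P₂.Gen-from (at-relabel x) (at-relabel y)
                   (reshift {g} {o₁} {o₂} {a} {b} _ _ (kind-of x) (kind-of y) x<y))
    (λ x y x<y → reshift {g} {o₂} {o₁} {a} {b} _ _ (kind-of x) (kind-of y)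
                   (P₂.Gen-to (at-relabel x) (at-relabel y) x<y))
    (λ x → sym (P₂.color-at (at-relabel x))))

lemma4p4 : (g : Lie) (a b : ℕ) →
    Iso g βα αβ a b ⇔ (a ≡ 0 ⊎ b ≡ 0)
lemma4p4 g a b = mk⇔ (only-if a b) (if a b)
  where
  only-if : ∀ a b → Iso g βα αβ a b → a ≡ 0 ⊎ b ≡ 0
  only-if zero     _        _   = inj₁ refl
  only-if (suc _)  zero     _   = inj₂ refl
  only-if (suc a') (suc b') iso =
    ⊥-elim (NoForkαβ.no-fork g a' (suc b') (transport-fork iso (Forkβα.fork g a' b')))

  if : ∀ a b → a ≡ 0 ⊎ b ≡ 0 → Iso g βα αβ a b
  if .0 b (inj₁ refl) = uniform-iso g βα αβ 0 b F01 (λ _ i<b → βα-F01 {0} {b} i<b) (λ _ _ → refl)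
  if a .0 (inj₂ refl) = uniform-iso g βα αβ a 0 F10 (λ _ _ → refl)
                          (λ _ i<a+0 → αβ-F10 {a} {0} (subst (_ <_) (+-identityʳ a) i<a+0))
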